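{- For all computations $M,N$ of $\lambda_{\copyright}$: (1) if $M (\to^{\mathsf s}_{\copyright})^* N$ then there is $L$ with $M (\to^{\mathsf s}_{\sigma\beta_c})^* L (\to^{\mathsf s}_{\iota})^* N$; (2) if $M \to_{\copyright}^* N$ then there are $L_1,L_2$ with $M (\to^{\mathsf s}_{\sigma\beta_c})^* L_1 (\to^{\neg\mathsf s}_{\sigma\beta_c})^* L_2 \to_{\iota}^* N$.
   Context: The computational core $\lambda_{\copyright}$ has values $V,W ::= x \mid \lambda x.M$ and computations $M,N,L ::= \,!V \mid VM$ ($x$ ranging over a countable set of variables, terms up to $\alpha$-renaming). Rules on computations: $\beta_c$: $(\lambda x.M)(!V) \mapsto M\{V/x\}$; $\mathsf{id}$: $(\lambda x.!x)M \mapsto M$; $\sigma$: $(\lambda y.N)((\lambda x.M)L) \mapsto (\lambda x.(\lambda y.N)M)L$ provided $x\notin \mathrm{fv}(N)$; $\iota$ is $\mathsf{id}$ minus $\beta_c$, i.e. $(\lambda x.!x)M\mapsto M$ where $M$ is not of the form $!V$; $\sigma\beta_c=\sigma\cup\beta_c$ and $\copyright=\beta_c\cup\mathsf{id}\cup\sigma$. Contexts: $C ::= [\,] \mid\, !(\lambda x.C) \mid VC \mid (\lambda x.C)M$; surface contexts $S ::= [\,]\mid VS\mid(\lambda x.S)M$. For a rule $\rho$: $\to_\rho$ is its closure under all contexts, $\to^{\mathsf s}_\rho$ its closure under surface contexts, $\to^{\neg\mathsf s}_\rho$ its closure under contexts that are not surface. $^*$ is reflexive–transitive closure. -}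

module Defs where

open import Data.Nat using (ℕ; zero; suc)
open import Data.Fin using (Fin; zero; suc)
open import Data.Product using (∃)
open import Data.Sum using (_⊎_)
open import Data.Unit using (⊤)
open import Relation.Nullary using (¬_)
open import Relation.Binary.PropositionalEquality using (_≡_)

-- Well-scoped de Bruijn syntax of the computational core λ©
-- (terms up to α-renaming). Val n / Com n : terms with free variables in Fin n.
mutual
  data Val (n : ℕ) : Set where
    var : Fin n → Val n
    lam : Com (suc n) → Val n

  data Com (n : ℕ) : Set where
    ret : Val n → Com n                -- !V
    app : Val n → Com n → Com n

Ren : ℕ → ℕ → Set
Ren n m = Fin n → Fin m

ext : ∀ {n m} → Ren n m → Ren (suc n) (suc m)
ext ρ zero = zero
ext ρ (suc i) = suc (ρ i)

mutual
  renV : ∀ {n m} → Ren n m → Val n → Val m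
  renV ρ (var i) = var (ρ i)
  renV ρ (lam M) = lam (renC (ext ρ) M)

  renC : ∀ {n m} → Ren n m → Com n → Com m
  renC ρ (ret V) = ret (renV ρ V)
  renC ρ (app V M) = app (renV ρ V) (renC ρ M)

Sub : ℕ → ℕ → Set
Sub n m = Fin n → Val m

exts : ∀ {n m} → Sub n m → Sub (suc n) (suc m)
exts σ zero = var zero
exts σ (suc i) = renV suc (σ i)

mutual
  subV : ∀ {n m} → Sub n m → Val n → Val m
  subV σ (var i) = σ i
  subV σ (lam M) = lam (subC (exts σ) M)

  subC : ∀ {n m} → Sub n m → Com n → Com m
  subC σ (ret V) = ret (subV σ V)
  subC σ (app V M) = app (subV σ V) (subC σ M)

sub0 : ∀ {n} → Val n → Sub (suc n) n
sub0 V zero = V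
sub0 V (suc i) = var i

-- M{V/x}, x the outermost bound variable of M
_[_] : ∀ {n} → Com (suc n) → Val n → Com n
M [ V ] = subC (sub0 V) M

Rule : Set₁
Rule = ∀ {n} → Com n → Com n → Set

_∪_ : Rule → Rule → Rule
(R ∪ Q) M N = R M N ⊎ Q M N

data βc : Rule where
  βc-rule : ∀ {n} (M : Com (suc n)) (V : Val n) →
    βc (app (lam M) (ret V)) (M [ V ])

data idR : Rule where
  id-rule : ∀ {n} (M : Com n) → idR (app (lam (ret (var zero))) M) M

-- σ : (λy.N)((λx.M)L) ↦ (λx.(λy.N)M)L, x ∉ fv(N).
-- In de Bruijn form the side condition is expressed by N being weakened
-- past the new binder x (renaming 0 ↦ 0, i+1 ↦ i+2).
data σR : Rule where
  σ-rule : ∀ {n} (N : Com (suc n)) (M : Com (suc n)) (L : Com n) →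
    σR (app (lam N) (app (lam M) L))
       (app (lam (app (lam (renC (ext suc) N)) M)) L)

data ιR : Rule where
  ι-rule : ∀ {n} (M : Com n) → (∀ (V : Val n) → ¬ (M ≡ ret V)) →
    ιR (app (lam (ret (var zero))) M) M

σβc : Rule
σβc = σR ∪ βc

©R : Rule
©R = (βc ∪ idR) ∪ σR

-- Contexts  C ::= [ ] | !(λx.C) | V C | (λx.C) M
-- Ctx n m : context with outer scope n whose hole has scope m.
data Ctx : ℕ → ℕ → Set where
  hole   : ∀ {n} → Ctx n n
  retLam : ∀ {n m} → Ctx (suc n) m → Ctx n m
  appV   : ∀ {n m} → Val n → Ctx n m → Ctx n m
  lamApp : ∀ {n m} → Ctx (suc n) m → Com n → Ctx n m

plug : ∀ {n m} → Ctx n m → Com m → Com n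
plug hole M = M
plug (retLam C) M = ret (lam (plug C M))
plug (appV V C) M = app V (plug C M)
plug (lamApp C L) M = app (lam (plug C M)) L

data Surface : ∀ {n m} → Ctx n m → Set where
  hole   : ∀ {n} → Surface (hole {n})
  appV   : ∀ {n m} (V : Val n) {S : Ctx n m} → Surface S → Surface (appV V S)
  lamApp : ∀ {n m} {S : Ctx (suc n) m} (L : Com n) → Surface S → Surface (lamApp S L)

data Closure (P : ∀ {n m} → Ctx n m → Set) (R : Rule) : Rule where
  step : ∀ {n m} (C : Ctx n m) {M N : Com m} → P C → R M N →
    Closure P R (plug C M) (plug C N)

AllCtx : ∀ {n m} → Ctx n m → Set
AllCtx _ = ⊤

NonSurface : ∀ {n m} → Ctx n m → Set
NonSurface C = ¬ Surface C

_⟶ : Rule → Rule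
R ⟶ = Closure AllCtx R

_⟶ˢ : Rule → Rule
R ⟶ˢ = Closure Surface R

_⟶¬ˢ : Rule → Rule
R ⟶¬ˢ = Closure NonSurface R

module Submission where

open import Defs
open import Data.Nat using (ℕ; zero; suc)
open import Data.Fin using (Fin; zero; suc)
open import Data.Product using (_×_; ∃-syntax; _,_)
open import Data.Sum using (inj₁; inj₂)
open import Data.Unit using (tt)
open import Data.Empty using (⊥-elim)
open import Relation.Nullary using (¬_)
open import Relation.Binary.PropositionalEquality
  using (_≡_; refl; sym; trans; cong; cong₂; subst; subst₂)
open import Relation.Binary.Construct.Closure.ReflexiveTransitive
  using (Star; ε; _◅_; _◅◅_; gmap; map)
open import Function using (_∘_)

-- Postponement of ι through an auxiliary "standard" relation Std μ M N: M first makes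
-- surface σβc-steps, and then N is obtained structurally, where at any position an
-- id-redex (λx.!x)K may be dropped. Std M M holds, and Std M N absorbs one more ©-step
-- at N: a βc-step needs the argument to be a value already on the left, which surface
-- σβc-steps provide; an id-step is recorded as a dropped id-redex; a σ-step reaches
-- through dropped id-redexes, each of which becomes one σ- and one βc-step on the left.
-- Finally, reading Std M N off as a reduction, a dropped id-redex whose argument has
-- become a value is a βc-redex, and otherwise an ι-redex, so all ι-steps come last.
-- The mode μ says whether reduction under !(λx.−) is allowed; without it the whole
-- argument stays in surface contexts.

ext-cong : ∀ {n m} {ρ ρ' : Ren n m} → (∀ i → ρ i ≡ ρ' i) → ∀ i → ext ρ i ≡ ext ρ' i
ext-cong e zero = refl
ext-cong e (suc i) = cong suc (e i)

mutual
  renV-cong : ∀ {n m} {ρ ρ' : Ren n m} → (∀ i → ρ i ≡ ρ' i) → ∀ V → renV ρ V ≡ renV ρ' V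
  renV-cong e (var i) = cong var (e i)
  renV-cong e (lam M) = cong lam (renC-cong (ext-cong e) M)

  renC-cong : ∀ {n m} {ρ ρ' : Ren n m} → (∀ i → ρ i ≡ ρ' i) → ∀ M → renC ρ M ≡ renC ρ' M
  renC-cong e (ret V) = cong ret (renV-cong e V)
  renC-cong e (app V M) = cong₂ app (renV-cong e V) (renC-cong e M)

ext-∘ : ∀ {n m k} (ρ : Ren n m) (ρ' : Ren m k) → ∀ i → ext ρ' (ext ρ i) ≡ ext (ρ' ∘ ρ) i
ext-∘ ρ ρ' zero = refl
ext-∘ ρ ρ' (suc i) = refl

mutual
  renV-renV : ∀ {n m k} (ρ : Ren n m) (ρ' : Ren m k) V → renV ρ' (renV ρ V) ≡ renV (ρ' ∘ ρ) V
  renV-renV ρ ρ' (var i) = refl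
  renV-renV ρ ρ' (lam M) =
    cong lam (trans (renC-renC (ext ρ) (ext ρ') M) (renC-cong (ext-∘ ρ ρ') M))

  renC-renC : ∀ {n m k} (ρ : Ren n m) (ρ' : Ren m k) M → renC ρ' (renC ρ M) ≡ renC (ρ' ∘ ρ) M
  renC-renC ρ ρ' (ret V) = cong ret (renV-renV ρ ρ' V)
  renC-renC ρ ρ' (app V M) = cong₂ app (renV-renV ρ ρ' V) (renC-renC ρ ρ' M)

exts-cong : ∀ {n m} {σ σ' : Sub n m} → (∀ i → σ i ≡ σ' i) → ∀ i → exts σ i ≡ exts σ' i
exts-cong e zero = refl
exts-cong e (suc i) = cong (renV suc) (e i)

mutual
  subV-cong : ∀ {n m} {σ σ' : Sub n m} → (∀ i → σ i ≡ σ' i) → ∀ V → subV σ V ≡ subV σ' V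
  subV-cong e (var i) = e i
  subV-cong e (lam M) = cong lam (subC-cong (exts-cong e) M)

  subC-cong : ∀ {n m} {σ σ' : Sub n m} → (∀ i → σ i ≡ σ' i) → ∀ M → subC σ M ≡ subC σ' M
  subC-cong e (ret V) = cong ret (subV-cong e V)
  subC-cong e (app V M) = cong₂ app (subV-cong e V) (subC-cong e M)

exts-ext : ∀ {n m k} (ρ : Ren n m) (σ : Sub m k) → ∀ i → exts σ (ext ρ i) ≡ exts (σ ∘ ρ) i
exts-ext ρ σ zero = refl
exts-ext ρ σ (suc i) = refl

mutual
  subV-renV : ∀ {n m k} (ρ : Ren n m) (σ : Sub m k) V → subV σ (renV ρ V) ≡ subV (σ ∘ ρ) V
  subV-renV ρ σ (var i) = refl
  subV-renV ρ σ (lam M) =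
    cong lam (trans (subC-renC (ext ρ) (exts σ) M) (subC-cong (exts-ext ρ σ) M))

  subC-renC : ∀ {n m k} (ρ : Ren n m) (σ : Sub m k) M → subC σ (renC ρ M) ≡ subC (σ ∘ ρ) M
  subC-renC ρ σ (ret V) = cong ret (subV-renV ρ σ V)
  subC-renC ρ σ (app V M) = cong₂ app (subV-renV ρ σ V) (subC-renC ρ σ M)

ext-exts : ∀ {n m k} (σ : Sub n m) (ρ : Ren m k) →
  ∀ i → renV (ext ρ) (exts σ i) ≡ exts (renV ρ ∘ σ) i
ext-exts σ ρ zero = refl
ext-exts σ ρ (suc i) = trans (renV-renV suc (ext ρ) (σ i)) (sym (renV-renV ρ suc (σ i)))

mutual
  renV-subV : ∀ {n m k} (σ : Sub n m) (ρ : Ren m k) V → renV ρ (subV σ V) ≡ subV (renV ρ ∘ σ) V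
  renV-subV σ ρ (var i) = refl
  renV-subV σ ρ (lam M) =
    cong lam (trans (renC-subC (exts σ) (ext ρ) M) (subC-cong (ext-exts σ ρ) M))

  renC-subC : ∀ {n m k} (σ : Sub n m) (ρ : Ren m k) M → renC ρ (subC σ M) ≡ subC (renV ρ ∘ σ) M
  renC-subC σ ρ (ret V) = cong ret (renV-subV σ ρ V)
  renC-subC σ ρ (app V M) = cong₂ app (renV-subV σ ρ V) (renC-subC σ ρ M)

exts-exts : ∀ {n m k} (σ : Sub n m) (σ' : Sub m k) →
  ∀ i → subV (exts σ') (exts σ i) ≡ exts (subV σ' ∘ σ) i
exts-exts σ σ' zero = refl
exts-exts σ σ' (suc i) = trans (subV-renV suc (exts σ') (σ i)) (sym (renV-subV σ' suc (σ i)))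

mutual
  subV-subV : ∀ {n m k} (σ : Sub n m) (σ' : Sub m k) V → subV σ' (subV σ V) ≡ subV (subV σ' ∘ σ) V
  subV-subV σ σ' (var i) = refl
  subV-subV σ σ' (lam M) =
    cong lam (trans (subC-subC (exts σ) (exts σ') M) (subC-cong (exts-exts σ σ') M))

  subC-subC : ∀ {n m k} (σ : Sub n m) (σ' : Sub m k) M → subC σ' (subC σ M) ≡ subC (subV σ' ∘ σ) M
  subC-subC σ σ' (ret V) = cong ret (subV-subV σ σ' V)
  subC-subC σ σ' (app V M) = cong₂ app (subV-subV σ σ' V) (subC-subC σ σ' M)

exts-var : ∀ {n} (i : Fin (suc n)) → exts var i ≡ var i
exts-var zero = refl
exts-var (suc i) = refl

mutual
  subV-var : ∀ {n} (V : Val n) → subV var V ≡ V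
  subV-var (var i) = refl
  subV-var (lam M) = cong lam (trans (subC-cong exts-var M) (subC-var M))

  subC-var : ∀ {n} (M : Com n) → subC var M ≡ M
  subC-var (ret V) = cong ret (subV-var V)
  subC-var (app V M) = cong₂ app (subV-var V) (subC-var M)

exts-var∘ : ∀ {n m} (ρ : Ren n m) → ∀ i → exts (var ∘ ρ) i ≡ var (ext ρ i)
exts-var∘ ρ zero = refl
exts-var∘ ρ (suc i) = refl

mutual
  renV-as-subV : ∀ {n m} (ρ : Ren n m) V → renV ρ V ≡ subV (var ∘ ρ) V
  renV-as-subV ρ (var i) = refl
  renV-as-subV ρ (lam M) =
    cong lam (trans (renC-as-subC (ext ρ) M) (sym (subC-cong (exts-var∘ ρ) M)))

  renC-as-subC : ∀ {n m} (ρ : Ren n m) M → renC ρ M ≡ subC (var ∘ ρ) M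
  renC-as-subC ρ (ret V) = cong ret (renV-as-subV ρ V)
  renC-as-subC ρ (app V M) = cong₂ app (renV-as-subV ρ V) (renC-as-subC ρ M)

subC-[] : ∀ {n m} (σ : Sub n m) (M : Com (suc n)) (V : Val n) →
  subC σ (M [ V ]) ≡ subC (exts σ) M [ subV σ V ]
subC-[] σ M V = trans (subC-subC (sub0 V) σ M)
  (sym (trans (subC-subC (exts σ) (sub0 (subV σ V)) M) (subC-cong agree M)))
  where
  agree : ∀ i → subV (sub0 (subV σ V)) (exts σ i) ≡ subV σ (sub0 V i)
  agree zero = refl
  agree (suc i) = trans (subV-renV suc (sub0 (subV σ V)) (σ i)) (subV-var (σ i))

subC-exts-weaken : ∀ {n m} (σ : Sub n m) (N : Com (suc n)) →
  subC (exts (exts σ)) (renC (ext suc) N) ≡ renC (ext suc) (subC (exts σ) N)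
subC-exts-weaken σ N = trans (subC-renC (ext suc) (exts (exts σ)) N)
  (sym (trans (renC-subC (exts σ) (ext suc) N) (subC-cong agree N)))
  where
  agree : ∀ i → renV (ext suc) (exts σ i) ≡ exts (exts σ) (ext suc i)
  agree zero = refl
  agree (suc i) = trans (renV-renV suc (ext suc) (σ i)) (sym (renV-renV suc suc (σ i)))

weaken-[var0] : ∀ {n} (N : Com (suc n)) → renC (ext suc) N [ var zero ] ≡ N
weaken-[var0] N =
  trans (subC-renC (ext suc) (sub0 (var zero)) N) (trans (subC-cong agree N) (subC-var N))
  where
  agree : ∀ i → sub0 (var zero) (ext suc i) ≡ var i
  agree zero = refl
  agree (suc i) = refl

data Mode : Set where
  surface full : Mode

data Step (R : Rule) : Mode → ∀ {n} → Com n → Com n → Set where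
  root     : ∀ {μ n} {M N : Com n} → R M N → Step R μ M N
  app-arg  : ∀ {μ n} (V : Val n) {M N : Com n} → Step R μ M N → Step R μ (app V M) (app V N)
  app-body : ∀ {μ n} {P P' : Com (suc n)} (M : Com n) →
             Step R μ P P' → Step R μ (app (lam P) M) (app (lam P') M)
  ret-body : ∀ {n} {P P' : Com (suc n)} → Step R full P P' → Step R full (ret (lam P)) (ret (lam P'))

data DeepStep (R : Rule) : Rule where
  ret-body : ∀ {n} {P P' : Com (suc n)} → Step R full P P' → DeepStep R (ret (lam P)) (ret (lam P'))
  app-arg  : ∀ {n} (V : Val n) {M N : Com n} → DeepStep R M N → DeepStep R (app V M) (app V N)
  app-body : ∀ {n} {P P' : Com (suc n)} (M : Com n) →
             DeepStep R P P' → DeepStep R (app (lam P) M) (app (lam P') M)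

surface⇒full : ∀ {R : Rule} {n} {M N : Com n} → Step R surface M N → Step R full M N
surface⇒full (root r) = root r
surface⇒full (app-arg V st) = app-arg V (surface⇒full st)
surface⇒full (app-body M st) = app-body M (surface⇒full st)

deep⇒full : ∀ {R : Rule} {n} {M N : Com n} → DeepStep R M N → Step R full M N
deep⇒full (ret-body st) = ret-body st
deep⇒full (app-arg V st) = app-arg V (deep⇒full st)
deep⇒full (app-body M st) = app-body M (deep⇒full st)

app-arg* : ∀ {R : Rule} {μ n} (V : Val n) {M N : Com n} →
  Star (Step R μ) M N → Star (Step R μ) (app V M) (app V N)
app-arg* V = gmap (app V) (app-arg V)

app-body* : ∀ {R : Rule} {μ n} {P P' : Com (suc n)} (M : Com n) →
  Star (Step R μ) P P' → Star (Step R μ) (app (lam P) M) (app (lam P') M)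
app-body* M = gmap (λ P → app (lam P) M) (app-body M)

ret-body* : ∀ {R : Rule} {n} {P P' : Com (suc n)} →
  Star (Step R full) P P' → Star (Step R full) (ret (lam P)) (ret (lam P'))
ret-body* = gmap (λ P → ret (lam P)) ret-body

deep-app-arg* : ∀ {R : Rule} {n} (V : Val n) {M N : Com n} →
  Star (DeepStep R) M N → Star (DeepStep R) (app V M) (app V N)
deep-app-arg* V = gmap (app V) (app-arg V)

deep-app-body* : ∀ {R : Rule} {n} {P P' : Com (suc n)} (M : Com n) →
  Star (DeepStep R) P P' → Star (DeepStep R) (app (lam P) M) (app (lam P') M)
deep-app-body* M = gmap (λ P → app (lam P) M) (app-body M)

plug⇒step : ∀ {R : Rule} {n m} (C : Ctx n m) {M N : Com m} → R M N → Step R full (plug C M) (plug C N)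
plug⇒step hole r = root r
plug⇒step (retLam C) r = ret-body (plug⇒step C r)
plug⇒step (appV V C) r = app-arg V (plug⇒step C r)
plug⇒step (lamApp C L) r = app-body L (plug⇒step C r)

plugˢ⇒step : ∀ {R : Rule} {n m} {C : Ctx n m} {M N : Com m} →
  Surface C → R M N → Step R surface (plug C M) (plug C N)
plugˢ⇒step hole r = root r
plugˢ⇒step (appV V sc) r = app-arg V (plugˢ⇒step sc r)
plugˢ⇒step (lamApp L sc) r = app-body L (plugˢ⇒step sc r)

⟶⇒step : ∀ {R : Rule} {n} {M N : Com n} → (R ⟶) M N → Step R full M N
⟶⇒step (step C _ r) = plug⇒step C r

⟶ˢ⇒step : ∀ {R : Rule} {n} {M N : Com n} → (R ⟶ˢ) M N → Step R surface M N
⟶ˢ⇒step (step C sc r) = plugˢ⇒step sc r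

step⇒⟶ : ∀ {R : Rule} {μ n} {M N : Com n} → Step R μ M N → (R ⟶) M N
step⇒⟶ (root r) = step hole tt r
step⇒⟶ (app-arg V st) with step⇒⟶ st
... | step C _ r = step (appV V C) tt r
step⇒⟶ (app-body M st) with step⇒⟶ st
... | step C _ r = step (lamApp C M) tt r
step⇒⟶ (ret-body st) with step⇒⟶ st
... | step C _ r = step (retLam C) tt r

step⇒⟶ˢ : ∀ {R : Rule} {n} {M N : Com n} → Step R surface M N → (R ⟶ˢ) M N
step⇒⟶ˢ (root r) = step hole hole r
step⇒⟶ˢ (app-arg V st) with step⇒⟶ˢ st
... | step C sc r = step (appV V C) (appV V sc) r
step⇒⟶ˢ (app-body M st) with step⇒⟶ˢ st
... | step C sc r = step (lamApp C M) (lamApp M sc) r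

deepStep⇒⟶¬ˢ : ∀ {R : Rule} {n} {M N : Com n} → DeepStep R M N → (R ⟶¬ˢ) M N
deepStep⇒⟶¬ˢ (ret-body st) with step⇒⟶ st
... | step C _ r = step (retLam C) (λ ()) r
deepStep⇒⟶¬ˢ (app-arg V st) with deepStep⇒⟶¬ˢ st
... | step C ns r = step (appV V C) (λ { (appV _ sc) → ns sc }) r
deepStep⇒⟶¬ˢ (app-body M st) with deepStep⇒⟶¬ˢ st
... | step C ns r = step (lamApp C M) (λ { (lamApp _ sc) → ns sc }) r

σβc-subst : ∀ {n m} (σ : Sub n m) {M N : Com n} → σβc M N → σβc (subC σ M) (subC σ N)
σβc-subst σ (inj₁ (σ-rule N M L)) =
  inj₁ (subst (λ X → σR (app (lam (subC (exts σ) N)) (app (lam (subC (exts σ) M)) (subC σ L)))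
                          (app (lam (app (lam X) (subC (exts σ) M))) (subC σ L)))
              (sym (subC-exts-weaken σ N))
              (σ-rule (subC (exts σ) N) (subC (exts σ) M) (subC σ L)))
σβc-subst σ (inj₂ (βc-rule M V)) =
  inj₂ (subst (βc _) (sym (subC-[] σ M V)) (βc-rule (subC (exts σ) M) (subV σ V)))

step-subst : ∀ {μ n m} (σ : Sub n m) {M N : Com n} →
  Step σβc μ M N → Step σβc μ (subC σ M) (subC σ N)
step-subst σ (root r) = root (σβc-subst σ r)
step-subst σ (app-arg V st) = app-arg (subV σ V) (step-subst σ st)
step-subst σ (app-body M st) = app-body (subC σ M) (step-subst (exts σ) st)
step-subst σ (ret-body st) = ret-body (step-subst (exts σ) st)

step-ren : ∀ {μ n m} (ρ : Ren n m) {M N : Com n} →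
  Step σβc μ M N → Step σβc μ (renC ρ M) (renC ρ N)
step-ren ρ {M} {N} st =
  subst₂ (Step σβc _) (sym (renC-as-subC ρ M)) (sym (renC-as-subC ρ N)) (step-subst (var ∘ ρ) st)

_↠ˢ_ : ∀ {n} → Com n → Com n → Set
_↠ˢ_ = Star (Step σβc surface)

_↠ᵈ_ : ∀ {n} → Com n → Com n → Set
_↠ᵈ_ = Star (DeepStep σβc)

idC : ∀ {n} → Com n → Com n
idC M = app (lam (ret (var zero))) M

id-ret↠ˢ : ∀ {n} (W : Val n) → idC (ret W) ↠ˢ ret W
id-ret↠ˢ W = root (inj₂ (βc-rule (ret (var zero)) W)) ◅ ε


mutual
  data Std : Mode → ∀ {n} → Com n → Com n → Set where
    σβc-then : ∀ {μ n} {M M₁ N : Com n} → Step σβc surface M M₁ → Std μ M₁ N → Std μ M N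
    drop-id  : ∀ {μ n} {M N : Com n} → Std μ M N → Std μ (idC M) N
    std-ret  : ∀ {μ n} {V V' : Val n} → StdArg μ V V' → Std μ (ret V) (ret V')
    std-app  : ∀ {μ n} {V V' : Val n} {M M' : Com n} →
               StdFun μ V V' → Std μ M M' → Std μ (app V M) (app V' M')

  data StdFun : Mode → ∀ {n} → Val n → Val n → Set where
    std-var : ∀ {μ n} (i : Fin n) → StdFun μ (var i) (var i)
    std-lam : ∀ {μ n} {P P' : Com (suc n)} → Std μ P P' → StdFun μ (lam P) (lam P')

  -- Surface steps never reach inside !V, so in surface mode V must stay fixed.
  StdArg : Mode → ∀ {n} → Val n → Val n → Set
  StdArg surface V V' = V ≡ V'
  StdArg full    V V' = StdFun full V V'

mutual
  Std-refl : ∀ {μ n} (M : Com n) → Std μ M M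
  Std-refl (ret V) = std-ret (StdArg-refl _ V)
  Std-refl (app V M) = std-app (StdFun-refl V) (Std-refl M)

  StdFun-refl : ∀ {μ n} (V : Val n) → StdFun μ V V
  StdFun-refl (var i) = std-var i
  StdFun-refl (lam P) = std-lam (Std-refl P)

  StdArg-refl : ∀ μ {n} (V : Val n) → StdArg μ V V
  StdArg-refl surface V = refl
  StdArg-refl full V = StdFun-refl V

StdArg⇒StdFun : ∀ μ {n} {V V' : Val n} → StdArg μ V V' → StdFun μ V V'
StdArg⇒StdFun surface {V = V} refl = StdFun-refl V
StdArg⇒StdFun full r = r

↠ˢ-then : ∀ {μ n} {M M₁ N : Com n} → M ↠ˢ M₁ → Std μ M₁ N → Std μ M N
↠ˢ-then ε d = d
↠ˢ-then (st ◅ ss) d = σβc-then st (↠ˢ-then ss d)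

mutual
  Std-ren : ∀ {μ n m} (ρ : Ren n m) {M N : Com n} → Std μ M N → Std μ (renC ρ M) (renC ρ N)
  Std-ren ρ (σβc-then st d) = σβc-then (step-ren ρ st) (Std-ren ρ d)
  Std-ren ρ (drop-id d) = drop-id (Std-ren ρ d)
  Std-ren ρ (std-ret r) = std-ret (StdArg-ren _ ρ r)
  Std-ren ρ (std-app h d) = std-app (StdFun-ren ρ h) (Std-ren ρ d)

  StdFun-ren : ∀ {μ n m} (ρ : Ren n m) {V W : Val n} → StdFun μ V W → StdFun μ (renV ρ V) (renV ρ W)
  StdFun-ren ρ (std-var i) = std-var (ρ i)
  StdFun-ren ρ (std-lam d) = std-lam (Std-ren (ext ρ) d)

  StdArg-ren : ∀ μ {n m} (ρ : Ren n m) {V W : Val n} → StdArg μ V W → StdArg μ (renV ρ V) (renV ρ W)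
  StdArg-ren surface ρ r = cong (renV ρ) r
  StdArg-ren full ρ r = StdFun-ren ρ r

StdArg-exts : ∀ μ {n m} {σ σ' : Sub n m} → (∀ i → StdArg μ (σ i) (σ' i)) →
  ∀ i → StdArg μ (exts σ i) (exts σ' i)
StdArg-exts μ r zero = StdArg-refl μ (var zero)
StdArg-exts μ r (suc i) = StdArg-ren μ suc (r i)

StdArg-sub0 : ∀ μ {n} {W W' : Val n} → StdArg μ W W' → ∀ i → StdArg μ (sub0 W i) (sub0 W' i)
StdArg-sub0 μ r zero = r
StdArg-sub0 μ r (suc i) = StdArg-refl μ (var i)

mutual
  Std-subst : ∀ {μ n m} {σ σ' : Sub n m} → (∀ i → StdArg μ (σ i) (σ' i)) →
    {M N : Com n} → Std μ M N → Std μ (subC σ M) (subC σ' N)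
  Std-subst r (σβc-then st d) = σβc-then (step-subst _ st) (Std-subst r d)
  Std-subst r (drop-id d) = drop-id (Std-subst r d)
  Std-subst r (std-ret a) = std-ret (StdArg-subst _ r a)
  Std-subst r (std-app h d) = std-app (StdFun-subst r h) (Std-subst r d)

  StdFun-subst : ∀ {μ n m} {σ σ' : Sub n m} → (∀ i → StdArg μ (σ i) (σ' i)) →
    {V W : Val n} → StdFun μ V W → StdFun μ (subV σ V) (subV σ' W)
  StdFun-subst {μ} r (std-var i) = StdArg⇒StdFun μ (r i)
  StdFun-subst {μ} r (std-lam d) = std-lam (Std-subst (StdArg-exts μ r) d)

  StdArg-subst : ∀ μ {n m} {σ σ' : Sub n m} → (∀ i → StdArg μ (σ i) (σ' i)) →
    {V W : Val n} → StdArg μ V W → StdArg μ (subV σ V) (subV σ' W)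
  StdArg-subst surface {σ = σ} r {W = W} refl = subV-cong r W
  StdArg-subst full r a = StdFun-subst r a

Std-ret-inv : ∀ {μ n} {M : Com n} {W : Val n} →
  Std μ M (ret W) → ∃[ W₀ ] (M ↠ˢ ret W₀ × StdArg μ W₀ W)
Std-ret-inv (σβc-then st d) with Std-ret-inv d
... | W₀ , ss , r = W₀ , st ◅ ss , r
Std-ret-inv (drop-id d) with Std-ret-inv d
... | W₀ , ss , r = W₀ , app-arg* _ ss ◅◅ id-ret↠ˢ W₀ , r
Std-ret-inv (std-ret r) = _ , ε , r

StdArg-var-inv : ∀ μ {n} {W : Val n} {i : Fin n} → StdArg μ W (var i) → W ≡ var i
StdArg-var-inv surface r = r
StdArg-var-inv full (std-var i) = refl

data UnderIds (μ : Mode) : ∀ {n} → Com n → Com (suc n) → Com n → Set where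
  redex    : ∀ {n} {P₀ P : Com (suc n)} {L₀ L : Com n} →
             Std μ P₀ P → Std μ L₀ L → UnderIds μ (app (lam P₀) L₀) P L
  under-id : ∀ {n} {K : Com n} {P L} → UnderIds μ K P L → UnderIds μ (idC K) P L

Std-app-lam-inv : ∀ {μ n} {M : Com n} {P L} →
  Std μ M (app (lam P) L) → ∃[ K ] (M ↠ˢ K × UnderIds μ K P L)
Std-app-lam-inv (σβc-then st d) with Std-app-lam-inv d
... | K , ss , u = K , st ◅ ss , u
Std-app-lam-inv (drop-id d) with Std-app-lam-inv d
... | K , ss , u = _ , app-arg* _ ss , under-id u
Std-app-lam-inv (std-app (std-lam dP) dL) = _ , ε , redex dP dL

-- Each pending id-redex is passed by a σ-step followed by this βc-step.
βc-var0-weaken : ∀ {n} (Q : Com (suc n)) (K : Com n) →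
  Step σβc surface (app (lam (app (lam (renC (ext suc) Q)) (ret (var zero)))) K) (app (lam Q) K)
βc-var0-weaken Q K =
  app-body K (subst (Step σβc surface _) (weaken-[var0] Q) (root (inj₂ (βc-rule (renC (ext suc) Q) (var zero)))))

σ-through-ids : ∀ {μ n} {K : Com n} {P L} {Q₀ Q : Com (suc n)} →
  UnderIds μ K P L → Std μ Q₀ Q →
  ∃[ X ] (app (lam Q₀) K ↠ˢ X × Std μ X (app (lam (app (lam (renC (ext suc) Q)) P)) L))
σ-through-ids {Q₀ = Q₀} (redex {P₀ = P₀} {L₀ = L₀} dP dL) dQ =
  _ , root (inj₁ (σ-rule Q₀ P₀ L₀)) ◅ ε ,
  std-app (std-lam (std-app (std-lam (Std-ren (ext suc) dQ)) dP)) dL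
σ-through-ids {Q₀ = Q₀} (under-id {K = K} u) dQ with σ-through-ids u dQ
... | X , ss , dX = X , root (inj₁ (σ-rule Q₀ (ret (var zero)) K)) ◅ βc-var0-weaken Q₀ K ◅ ss , dX

ret-©-normal : ∀ {n} {V : Val n} {N : Com n} → ¬ ©R (ret V) N
ret-©-normal (inj₁ (inj₁ ()))
ret-©-normal (inj₁ (inj₂ ()))
ret-©-normal (inj₂ ())

Std-absorb : ∀ {μ n} {M N N' : Com n} → Std μ M N → Step ©R μ N N' → Std μ M N'
Std-absorb (σβc-then st d) s = σβc-then st (Std-absorb d s)
Std-absorb (drop-id d) s = drop-id (Std-absorb d s)
Std-absorb (std-ret _) (root r) = ⊥-elim (ret-©-normal r)
Std-absorb {full} (std-ret (std-lam d)) (ret-body s) = std-ret (std-lam (Std-absorb d s))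
Std-absorb (std-app h d) (app-arg V s) = std-app h (Std-absorb d s)
Std-absorb (std-app (std-lam d) dM) (app-body M s) = std-app (std-lam (Std-absorb d s)) dM
Std-absorb {μ} (std-app (std-lam {P = P₀} dP) d) (root (inj₁ (inj₁ (βc-rule P W)))) with Std-ret-inv d
... | W₀ , ss , r =
  ↠ˢ-then (app-arg* _ ss ◅◅ root (inj₂ (βc-rule P₀ W₀)) ◅ ε) (Std-subst (StdArg-sub0 μ r) dP)
Std-absorb {μ} (std-app (std-lam dP) d) (root (inj₁ (inj₂ (id-rule M)))) with Std-ret-inv dP
... | W₀ , ss , r with StdArg-var-inv μ r
... | refl = ↠ˢ-then (app-body* _ ss) (drop-id d)
Std-absorb (std-app (std-lam dQ) d) (root (inj₂ (σ-rule Q P L))) with Std-app-lam-inv d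
... | K , ss , u with σ-through-ids u dQ
... | X , ss' , dX = ↠ˢ-then (app-arg* _ ss ◅◅ ss') dX

Std-absorb* : ∀ {μ n} {M N N' : Com n} → Std μ M N → Star (Step ©R μ) N N' → Std μ M N'
Std-absorb* d ε = d
Std-absorb* d (s ◅ ss) = Std-absorb* (Std-absorb d s) ss

drop-id-surface : ∀ {n} {M L N : Com n} → M ↠ˢ L → Star (Step ιR surface) L N →
  ∃[ L' ] (idC M ↠ˢ L' × Star (Step ιR surface) L' N)
drop-id-surface {L = ret W} a c = ret W , app-arg* _ a ◅◅ id-ret↠ˢ W , c
drop-id-surface {L = app V X} a c = idC (app V X) , app-arg* _ a , root (ι-rule (app V X) (λ _ ())) ◅ c

Std⇒surface : ∀ {n} {M N : Com n} → Std surface M N → ∃[ L ] (M ↠ˢ L × Star (Step ιR surface) L N)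
Std⇒surface (σβc-then st d) with Std⇒surface d
... | L , a , c = L , st ◅ a , c
Std⇒surface (drop-id d) with Std⇒surface d
... | L , a , c = drop-id-surface a c
Std⇒surface (std-ret refl) = _ , ε , ε
Std⇒surface (std-app (std-var i) d) with Std⇒surface d
... | L , a , c = _ , app-arg* _ a , app-arg* _ c
Std⇒surface (std-app (std-lam dP) d) with Std⇒surface dP | Std⇒surface d
... | A , aP , cP | L , a , c = _ , app-body* _ aP ◅◅ app-arg* _ a , app-body* _ cP ◅◅ app-arg* _ c

deep-ret-body* : ∀ {n} {P P' : Com (suc n)} → Star (Step σβc full) P P' → ret (lam P) ↠ᵈ ret (lam P')
deep-ret-body* = gmap (λ P → ret (lam P)) ret-body

app-↠ᵈ-not-ret : ∀ {n} {V : Val n} {X B : Com n} → app V X ↠ᵈ B → ∀ W → ¬ (B ≡ ret W)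
app-↠ᵈ-not-ret ε W ()
app-↠ᵈ-not-ret (app-arg V st ◅ ss) = app-↠ᵈ-not-ret ss
app-↠ᵈ-not-ret (app-body M st ◅ ss) = app-↠ᵈ-not-ret ss

Factorization : ∀ {n} → Com n → Com n → Set
Factorization M N = ∃[ L₁ ] ∃[ L₂ ] (M ↠ˢ L₁ × L₁ ↠ᵈ L₂ × Star (Step ιR full) L₂ N)

drop-id-full : ∀ {n} {M L₁ L₂ N : Com n} →
  M ↠ˢ L₁ → L₁ ↠ᵈ L₂ → Star (Step ιR full) L₂ N → Factorization (idC M) N
drop-id-full {L₁ = ret W} a b c = ret W , _ , app-arg* _ a ◅◅ id-ret↠ˢ W , b , c
drop-id-full {L₁ = app V X} {L₂} a b c =
  idC (app V X) , idC L₂ , app-arg* _ a , deep-app-arg* _ b , root (ι-rule L₂ (app-↠ᵈ-not-ret b)) ◅ c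

Std⇒full : ∀ {n} {M N : Com n} → Std full M N → Factorization M N
Std⇒full (σβc-then st d) with Std⇒full d
... | L₁ , L₂ , a , b , c = L₁ , L₂ , st ◅ a , b , c
Std⇒full (drop-id d) with Std⇒full d
... | L₁ , L₂ , a , b , c = drop-id-full a b c
Std⇒full (std-ret (std-var i)) = _ , _ , ε , ε , ε
Std⇒full (std-ret (std-lam dP)) with Std⇒full dP
... | A , B , a , b , c =
  _ , _ , ε , deep-ret-body* (map surface⇒full a) ◅◅ deep-ret-body* (map deep⇒full b) , ret-body* c
Std⇒full (std-app (std-var i) d) with Std⇒full d
... | L₁ , L₂ , a , b , c = _ , _ , app-arg* _ a , deep-app-arg* _ b , app-arg* _ c
Std⇒full (std-app (std-lam dP) d) with Std⇒full dP | Std⇒full d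
... | A₁ , B₁ , aP , bP , cP | A₂ , B₂ , a , b , c =
  _ , _ , app-body* _ aP ◅◅ app-arg* _ a , deep-app-body* _ bP ◅◅ deep-app-arg* _ b ,
  app-body* _ cP ◅◅ app-arg* _ c

surface-ι-postponement : ∀ {n} (M N : Com n) → Star (©R ⟶ˢ) M N →
  ∃[ L ] (Star (σβc ⟶ˢ) M L × Star (ιR ⟶ˢ) L N)
surface-ι-postponement M N ss with Std⇒surface (Std-absorb* (Std-refl M) (map ⟶ˢ⇒step ss))
... | L , a , c = L , map step⇒⟶ˢ a , map step⇒⟶ˢ c

ι-postponement : ∀ {n} (M N : Com n) → Star (©R ⟶) M N →
  ∃[ L₁ ] ∃[ L₂ ] (Star (σβc ⟶ˢ) M L₁ × Star (σβc ⟶¬ˢ) L₁ L₂ × Star (ιR ⟶) L₂ N)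
ι-postponement M N ss with Std⇒full (Std-absorb* (Std-refl M) (map ⟶⇒step ss))
... | L₁ , L₂ , a , b , c = L₁ , L₂ , map step⇒⟶ˢ a , map deepStep⇒⟶¬ˢ b , map step⇒⟶ c

mainTheorem4 : (∀ {n : ℕ} (M N : Com n) →
    Star (©R ⟶ˢ) M N →
    ∃[ L ] (Star (σβc ⟶ˢ) M L × Star (ιR ⟶ˢ) L N))
    × (∀ {n : ℕ} (M N : Com n) →
    Star (©R ⟶) M N →
    ∃[ L₁ ] ∃[ L₂ ] (Star (σβc ⟶ˢ) M L₁ × Star (σβc ⟶¬ˢ) L₁ L₂ × Star (ιR ⟶) L₂ N))
mainTheorem4 = surface-ι-postponement , ι-postponement
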